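{- For all integers $k \ge 2$ and $m \ge 3$ and every graph $H$, we have $\chi'_{st}(C_{k\cdot m} \,\square\, H) \le \chi'_{st}(C_m \,\square\, H)$.
   Context: A star edge-coloring of a graph $G$ is a proper edge-coloring of $G$ in which there is no bichromatic path and no bichromatic cycle of length four (i.e., with four edges). The star chromatic index $\chi'_{st}(G)$ is the minimum number of colors in a star edge-coloring of $G$. $C_m$ denotes the cycle on $m$ vertices. $G \,\square\, H$ denotes the Cartesian product: vertex set $V(G)\times V(H)$, with $(u,v)(u',v')$ an edge iff either $uu'\in E(G)$ and $v=v'$, or $u=u'$ and $vv'\in E(H)$. -}

module Defs where

open import Data.Nat using (ℕ; zero; suc)
open import Data.Fin using (Fin; toℕ)
open import Data.Product using (Σ; _×_; _,_)
open import Data.Sum using (_⊎_)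
open import Data.Empty using (⊥)
open import Relation.Binary.PropositionalEquality using (_≡_)
open import Relation.Nullary using (¬_)

AdjRel : Set → Set₁
AdjRel V = V → V → Set

record Graph (V : Set) : Set₁ where
  field
    Adj    : AdjRel V
    sym    : ∀ {u v} → Adj u v → Adj v u
    irrefl : ∀ {u} → ¬ Adj u u
open Graph public

-- The cycle C_m on vertices 0,…,m-1 : i ~ i+1 and m-1 ~ 0.
-- (A simple graph for m ≥ 3.)
CycleAdj : (m : ℕ) → AdjRel (Fin m)
CycleAdj m i j =
  (suc (toℕ i) ≡ toℕ j) ⊎ (suc (toℕ j) ≡ toℕ i)
  ⊎ ((suc (toℕ i) ≡ m × toℕ j ≡ 0) ⊎ (suc (toℕ j) ≡ m × toℕ i ≡ 0))

_□_ : {A B : Set} → AdjRel A → AdjRel B → AdjRel (A × B)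
(G □ H) (a , b) (a' , b') = (G a a' × b ≡ b') ⊎ (a ≡ a' × H b b')

-- An edge colouring assigns a colour to every ordered pair of vertices;
-- only values on edges matter, and it must be symmetric on edges.
record IsStarEdgeColouring {V : Set} (G : AdjRel V) (c : ℕ)
       (col : V → V → Fin c) : Set where
  field
    symmetric : ∀ {u v} → G u v → col u v ≡ col v u
    proper    : ∀ {u v w} → G u v → G u w → ¬ (v ≡ w) → ¬ (col u v ≡ col u w)
    -- no bichromatic path with four edges v0 v1 v2 v3 v4 (distinct vertices);
    -- in a proper colouring, bichromatic means the colours alternate.
    noPath4   : ∀ {v0 v1 v2 v3 v4} →
      G v0 v1 → G v1 v2 → G v2 v3 → G v3 v4 →
      ¬ (v0 ≡ v1) → ¬ (v0 ≡ v2) → ¬ (v0 ≡ v3) → ¬ (v0 ≡ v4) →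
      ¬ (v1 ≡ v2) → ¬ (v1 ≡ v3) → ¬ (v1 ≡ v4) →
      ¬ (v2 ≡ v3) → ¬ (v2 ≡ v4) → ¬ (v3 ≡ v4) →
      ¬ (col v0 v1 ≡ col v2 v3 × col v1 v2 ≡ col v3 v4)
    noCycle4  : ∀ {v0 v1 v2 v3} →
      G v0 v1 → G v1 v2 → G v2 v3 → G v3 v0 →
      ¬ (v0 ≡ v1) → ¬ (v0 ≡ v2) → ¬ (v0 ≡ v3) →
      ¬ (v1 ≡ v2) → ¬ (v1 ≡ v3) → ¬ (v2 ≡ v3) →
      ¬ (col v0 v1 ≡ col v2 v3 × col v1 v2 ≡ col v3 v0)

-- G admits a star edge-colouring with c colours (i.e. χ'_st(G) ≤ c).
StarColourable : {V : Set} → AdjRel V → ℕ → Set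
StarColourable {V} G c = Σ (V → V → Fin c) (IsStarEdgeColouring G c)

module Submission where

-- Reduction modulo m, i ↦ i mod m, maps C_{km} onto C_m so that each vertex's two
-- neighbours go bijectively to the two neighbours of its image (this needs m ≥ 3),
-- and the same holds for (i , h) ↦ (i mod m , h) on the products with H.
-- Pulling a star edge-colouring back along such a local isomorphism keeps it
-- proper, and an alternating path or 4-cycle upstairs maps to an alternating
-- non-backtracking walk downstairs, which a star edge-colouring forbids as well.

open import Defs hiding (sym)
open import Data.Nat using (ℕ; suc; _≤_; _<_; _*_; _%_; _/_; NonZero; s≤s)
open import Data.Nat.Properties using (suc-injective; <-irrefl; <⇒≤; m≤n⇒m<n∨m≡n)
open import Data.Nat.DivMod
  using (m≡m%n+[m/n]*n; %-congˡ; [m+kn]%n≡m%n; m<n⇒m%n≡m; n%n≡0; m%n<n)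
open import Data.Fin using (Fin; toℕ; fromℕ<) renaming (_≟_ to _≟ᶠ_)
open import Data.Fin.Properties using (toℕ-fromℕ<; toℕ-injective; toℕ<n)
open import Data.Product using (_×_; _,_; proj₁; proj₂; map₁)
open import Data.Product.Properties using (≡-dec)
open import Data.Sum using (_⊎_; inj₁; inj₂; swap; map)
open import Data.Empty using (⊥-elim)
open import Relation.Nullary using (¬_; yes; no)
open import Relation.Binary.Definitions using (Symmetric; DecidableEquality)
open import Relation.Binary.PropositionalEquality
  using (_≡_; _≢_; refl; sym; trans; cong; subst; subst₂)

Loopless : {V : Set} → AdjRel V → Set
Loopless G = ∀ {u} → ¬ G u u

adj⇒≢ : {V : Set} (G : AdjRel V) → Loopless G → ∀ {u v} → G u v → u ≢ v
adj⇒≢ G loopless e refl = loopless e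

record LocallyInjectiveHom {V W : Set} (G : AdjRel V) (G' : AdjRel W) (φ : V → W) : Set where
  field
    preserves-adj           : ∀ {u v} → G u v → G' (φ u) (φ v)
    injective-on-neighbours : ∀ {u v w} → G u v → G u w → φ v ≡ φ w → v ≡ w

module _ {W : Set} {G : AdjRel W} {c : ℕ} {col : W → W → Fin c}
         (star : IsStarEdgeColouring G c col)
         (sym-G : Symmetric G) (loopless : Loopless G) (_≟_ : DecidableEquality W) where
  open IsStarEdgeColouring star

  private
    ends≢ : ∀ {u v} → G u v → u ≢ v
    ends≢ = adj⇒≢ G loopless

  -- A walk closing up at w0 = w3 or w1 = w4 has two equally coloured edges at one
  -- vertex; at w0 = w4 it is a 4-cycle; otherwise it is a path.
  noAlternatingWalk4 : ∀ {w0 w1 w2 w3 w4} →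
    G w0 w1 → G w1 w2 → G w2 w3 → G w3 w4 → w0 ≢ w2 → w1 ≢ w3 → w2 ≢ w4 →
    ¬ (col w0 w1 ≡ col w2 w3 × col w1 w2 ≡ col w3 w4)
  noAlternatingWalk4 {w0} {w1} {w2} {w3} {w4} e01 e12 e23 e34 w0≢w2 w1≢w3 w2≢w4 (p , q)
    with w0 ≟ w3 | w1 ≟ w4 | w0 ≟ w4
  ... | yes refl | _ | _ =
    proper e01 (sym-G e23) (ends≢ e12) (trans p (symmetric e23))
  ... | no _ | yes refl | _ =
    proper e12 (sym-G e34) (ends≢ e23) (trans q (symmetric e34))
  ... | no w0≢w3 | no _ | yes refl =
    noCycle4 e01 e12 e23 e34 (ends≢ e01) w0≢w2 w0≢w3
      (ends≢ e12) w1≢w3 (ends≢ e23) (p , q)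
  ... | no w0≢w3 | no w1≢w4 | no w0≢w4 =
    noPath4 e01 e12 e23 e34 (ends≢ e01) w0≢w2 w0≢w3 w0≢w4
      (ends≢ e12) w1≢w3 w1≢w4 (ends≢ e23) w2≢w4
      (ends≢ e34) (p , q)

module _ {V W : Set} {G : AdjRel V} {G' : AdjRel W} {φ : V → W}
         (sym-G : Symmetric G) (sym-G' : Symmetric G') (loopless' : Loopless G')
         (_≟_ : DecidableEquality W) (lih : LocallyInjectiveHom G G' φ) where
  open LocallyInjectiveHom lih

  private
    ends≢ : ∀ {u v} → G' u v → u ≢ v
    ends≢ = adj⇒≢ G' loopless'

    ends-distinct : ∀ {a b d} → G a b → G b d → a ≢ d → φ a ≢ φ d
    ends-distinct e1 e2 a≢d eq = a≢d (injective-on-neighbours (sym-G e1) e2 eq)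

  isStarEdgeColouring-pullback : ∀ {c col} → IsStarEdgeColouring G' c col →
    IsStarEdgeColouring G c (λ u v → col (φ u) (φ v))
  isStarEdgeColouring-pullback star = record
    { symmetric = λ e → symmetric (preserves-adj e)
    ; proper = λ e1 e2 v≢w → proper (preserves-adj e1) (preserves-adj e2)
        (λ eq → v≢w (injective-on-neighbours e1 e2 eq))
    ; noPath4 = λ e01 e12 e23 e34 _ v0≢v2 _ _ _ v1≢v3 _ _ v2≢v4 _ →
        noAlternatingWalk4 star sym-G' loopless' _≟_
          (preserves-adj e01) (preserves-adj e12) (preserves-adj e23) (preserves-adj e34)
          (ends-distinct e01 e12 v0≢v2) (ends-distinct e12 e23 v1≢v3)
          (ends-distinct e23 e34 v2≢v4)
    ; noCycle4 = λ e01 e12 e23 e30 _ v0≢v2 _ _ v1≢v3 _ →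
        noCycle4 (preserves-adj e01) (preserves-adj e12) (preserves-adj e23) (preserves-adj e30)
          (ends≢ (preserves-adj e01)) (ends-distinct e01 e12 v0≢v2)
          (λ eq → ends≢ (preserves-adj e30) (sym eq))
          (ends≢ (preserves-adj e12)) (ends-distinct e12 e23 v1≢v3)
          (ends≢ (preserves-adj e23))
    }
    where open IsStarEdgeColouring star

  starColourable-pullback : ∀ {c} → StarColourable G' c → StarColourable G c
  starColourable-pullback (col , star) = _ , isStarEdgeColouring-pullback star

module _ {A B : Set} {G : AdjRel A} {H : AdjRel B} where

  □-symmetric : Symmetric G → Symmetric H → Symmetric (G □ H)
  □-symmetric sym-G _     {_ , _} {_ , _} (inj₁ (e , refl)) = inj₁ (sym-G e , refl)
  □-symmetric _     sym-H {_ , _} {_ , _} (inj₂ (refl , e)) = inj₂ (refl , sym-H e)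

  □-loopless : Loopless G → Loopless H → Loopless (G □ H)
  □-loopless loopless-G _ {_ , _} (inj₁ (e , _)) = loopless-G e
  □-loopless _ loopless-H {_ , _} (inj₂ (_ , e)) = loopless-H e

  □-locallyInjectiveHom : {A' : Set} {G' : AdjRel A'} {φ : A → A'} → Loopless G' →
    LocallyInjectiveHom G G' φ → LocallyInjectiveHom (G □ H) (G' □ H) (map₁ φ)
  □-locallyInjectiveHom {G' = G'} {φ} loopless' lih = record
    { preserves-adj = preserves
    ; injective-on-neighbours = injective
    }
    where
    open LocallyInjectiveHom lih

    preserves : ∀ {u v} → (G □ H) u v → (G' □ H) (map₁ φ u) (map₁ φ v)
    preserves {_ , _} {_ , _} (inj₁ (e , refl)) = inj₁ (preserves-adj e , refl)
    preserves {_ , _} {_ , _} (inj₂ (refl , e)) = inj₂ (refl , e)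

    -- In the mixed cases a G-neighbour of a would map to φ a, a loop of G'.
    injective : ∀ {u v w} → (G □ H) u v → (G □ H) u w → map₁ φ v ≡ map₁ φ w → v ≡ w
    injective {_ , _} {_ , _} {_ , _} (inj₁ (e , refl)) (inj₁ (e' , refl)) eq =
      cong (_, _) (injective-on-neighbours e e' (cong proj₁ eq))
    injective {_ , _} {_ , _} {_ , _} (inj₂ (refl , _)) (inj₂ (refl , _)) eq =
      cong (_ ,_) (cong proj₂ eq)
    injective {_ , _} {_ , _} {_ , _} (inj₁ (e , refl)) (inj₂ (refl , _)) eq =
      ⊥-elim (loopless' (subst (G' _) (cong proj₁ eq) (preserves-adj e)))
    injective {_ , _} {_ , _} {_ , _} (inj₂ (refl , _)) (inj₁ (e , refl)) eq =
      ⊥-elim (loopless' (subst (G' _) (sym (cong proj₁ eq)) (preserves-adj e)))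

SuccMod : ℕ → ℕ → ℕ → Set
SuccMod N a b = suc a ≡ b ⊎ (suc a ≡ N × b ≡ 0)

module _ {N : ℕ} {i j : Fin N} where

  cycleAdj⇒succMod : CycleAdj N i j →
    SuccMod N (toℕ i) (toℕ j) ⊎ SuccMod N (toℕ j) (toℕ i)
  cycleAdj⇒succMod (inj₁ e)               = inj₁ (inj₁ e)
  cycleAdj⇒succMod (inj₂ (inj₁ e))        = inj₂ (inj₁ e)
  cycleAdj⇒succMod (inj₂ (inj₂ (inj₁ e))) = inj₁ (inj₂ e)
  cycleAdj⇒succMod (inj₂ (inj₂ (inj₂ e))) = inj₂ (inj₂ e)

  succMod⇒cycleAdj : SuccMod N (toℕ i) (toℕ j) ⊎ SuccMod N (toℕ j) (toℕ i) →
    CycleAdj N i j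
  succMod⇒cycleAdj (inj₁ (inj₁ e)) = inj₁ e
  succMod⇒cycleAdj (inj₂ (inj₁ e)) = inj₂ (inj₁ e)
  succMod⇒cycleAdj (inj₁ (inj₂ e)) = inj₂ (inj₂ (inj₁ e))
  succMod⇒cycleAdj (inj₂ (inj₂ e)) = inj₂ (inj₂ (inj₂ e))

succMod-functional : ∀ {N a b b'} → b < N → b' < N →
  SuccMod N a b → SuccMod N a b' → b ≡ b'
succMod-functional _   _    (inj₁ e)       (inj₁ e')       = trans (sym e) e'
succMod-functional b<N _    (inj₁ e)       (inj₂ (e' , _)) = ⊥-elim (<-irrefl (trans (sym e) e') b<N)
succMod-functional _   b'<N (inj₂ (e , _)) (inj₁ e')       = ⊥-elim (<-irrefl (trans (sym e') e) b'<N)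
succMod-functional _   _    (inj₂ (_ , z)) (inj₂ (_ , z')) = trans z (sym z')

succMod-injective : ∀ {N a a' b} → SuccMod N a b → SuccMod N a' b → a ≡ a'
succMod-injective (inj₁ e)       (inj₁ e')       = suc-injective (trans e (sym e'))
succMod-injective (inj₁ refl)    (inj₂ (_ , ()))
succMod-injective (inj₂ (_ , ())) (inj₁ refl)
succMod-injective (inj₂ (e , _)) (inj₂ (e' , _)) = suc-injective (trans e (sym e'))

succMod-irreflexive : ∀ {N a} → 2 ≤ N → ¬ SuccMod N a a
succMod-irreflexive (s≤s (s≤s _)) (inj₂ (() , refl))

succMod-asymmetric : ∀ {N a b} → 3 ≤ N → SuccMod N a b → ¬ SuccMod N b a
succMod-asymmetric _                   (inj₁ refl)       (inj₁ ())
succMod-asymmetric (s≤s (s≤s (s≤s _))) (inj₁ refl)       (inj₂ (() , refl))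
succMod-asymmetric (s≤s (s≤s (s≤s _))) (inj₂ (() , refl)) (inj₁ refl)
succMod-asymmetric (s≤s (s≤s (s≤s _))) (inj₂ (() , refl)) (inj₂ (_ , refl))

cycle-symmetric : ∀ {N} → Symmetric (CycleAdj N)
cycle-symmetric e = succMod⇒cycleAdj (swap (cycleAdj⇒succMod e))

cycle-loopless : ∀ {N} → 2 ≤ N → Loopless (CycleAdj N)
cycle-loopless 2≤N e with cycleAdj⇒succMod e
... | inj₁ s = succMod-irreflexive 2≤N s
... | inj₂ s = succMod-irreflexive 2≤N s

module _ {m : ℕ} .{{_ : NonZero m}} where

  suc-% : ∀ a → suc a % m ≡ suc (a % m) % m
  suc-% a = trans (%-congˡ (cong suc (m≡m%n+[m/n]*n a m)))
                  ([m+kn]%n≡m%n (suc (a % m)) (a / m) m)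

  succMod-% : ∀ a → SuccMod m (a % m) (suc a % m)
  succMod-% a with m≤n⇒m<n∨m≡n (m%n<n a m)
  ... | inj₁ 1+a%m<m = inj₁ (sym (trans (suc-% a) (m<n⇒m%n≡m 1+a%m<m)))
  ... | inj₂ 1+a%m≡m = inj₂ (1+a%m≡m , trans (suc-% a) (trans (%-congˡ 1+a%m≡m) (n%n≡0 m)))

  succMod-reduce : ∀ k {a b} → SuccMod (k * m) a b → SuccMod m (a % m) (b % m)
  succMod-reduce k {a} (inj₁ refl)       = succMod-% a
  succMod-reduce k {a} (inj₂ (e , refl)) =
    subst (SuccMod m (a % m)) (trans (%-congˡ e) ([m+kn]%n≡m%n 0 k m)) (succMod-% a)

  reduce : ∀ {N} → Fin N → Fin m
  reduce i = fromℕ< (m%n<n (toℕ i) m)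

  toℕ-reduce : ∀ {N} (i : Fin N) → toℕ (reduce i) ≡ toℕ i % m
  toℕ-reduce i = toℕ-fromℕ< (m%n<n (toℕ i) m)

  succMod-reduce-Fin : ∀ k {i j : Fin (k * m)} → SuccMod (k * m) (toℕ i) (toℕ j) →
    SuccMod m (toℕ (reduce i)) (toℕ (reduce j))
  succMod-reduce-Fin k {i} {j} s =
    subst₂ (SuccMod m) (sym (toℕ-reduce i)) (sym (toℕ-reduce j)) (succMod-reduce k s)

  reduce-≡⇒%-≡ : ∀ {N} {i j : Fin N} → reduce i ≡ reduce j → toℕ i % m ≡ toℕ j % m
  reduce-≡⇒%-≡ {i = i} {j} eq =
    trans (sym (toℕ-reduce i)) (trans (cong toℕ eq) (toℕ-reduce j))

  -- Two neighbours on the same side of i are equal already upstairs; neighbours on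
  -- opposite sides would make reduce j both successor and predecessor of reduce i.
  reduce-locallyInjectiveHom : ∀ k → 3 ≤ m →
    LocallyInjectiveHom (CycleAdj (k * m)) (CycleAdj m) reduce
  reduce-locallyInjectiveHom k 3≤m = record
    { preserves-adj           = λ e →
        succMod⇒cycleAdj (map (succMod-reduce-Fin k) (succMod-reduce-Fin k) (cycleAdj⇒succMod e))
    ; injective-on-neighbours = injective
    }
    where
    injective : ∀ {i j j'} → CycleAdj (k * m) i j → CycleAdj (k * m) i j' →
      reduce j ≡ reduce j' → j ≡ j'
    injective {i} {j} {j'} e e' eq with cycleAdj⇒succMod e | cycleAdj⇒succMod e'
    ... | inj₁ s | inj₁ s' = toℕ-injective (succMod-functional (toℕ<n j) (toℕ<n j') s s')
    ... | inj₂ s | inj₂ s' = toℕ-injective (succMod-injective s s')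
    ... | inj₁ s | inj₂ s' = ⊥-elim (succMod-asymmetric 3≤m
      (subst (SuccMod m (toℕ i % m)) (reduce-≡⇒%-≡ eq) (succMod-reduce k s))
      (succMod-reduce k s'))
    ... | inj₂ s | inj₁ s' = ⊥-elim (succMod-asymmetric 3≤m
      (succMod-reduce k s')
      (subst (λ x → SuccMod m x (toℕ i % m)) (reduce-≡⇒%-≡ eq) (succMod-reduce k s)))

lemma4 : (k m : ℕ) → 2 ≤ k → 3 ≤ m → (n : ℕ) → (H : Graph (Fin n)) →
    (c : ℕ) → StarColourable (CycleAdj m □ Adj H) c →
    StarColourable (CycleAdj (k * m) □ Adj H) c
lemma4 k (suc m) _ 3≤m@(s≤s _) n H c =
  starColourable-pullback
    (□-symmetric {G = CycleAdj (k * suc m)} cycle-symmetric (Graph.sym H))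
    (□-symmetric {G = CycleAdj (suc m)} cycle-symmetric (Graph.sym H))
    (□-loopless {G = CycleAdj (suc m)} {H = Adj H} (cycle-loopless 2≤m) (Graph.irrefl H))
    (≡-dec _≟ᶠ_ _≟ᶠ_)
    (□-locallyInjectiveHom (cycle-loopless 2≤m) (reduce-locallyInjectiveHom k 3≤m))
  where
  2≤m : 2 ≤ suc m
  2≤m = <⇒≤ 3≤m
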